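{- Let $G$ be a graph with vertices $v_1,\dots,v_n$ ($n\ge1$), let $a_1,\dots,a_n$ be positive integers, and let $d=\deg_G v_n$, where the neighbours of $v_n$ in $G$ are exactly $v_{n-1},\dots,v_{n-d}$. Then $$\widetilde P_{G_n}(\mathbf{x})=\widetilde P_{G_{n-1}}(\mathbf{x})+x_n(a_n-1)\,\widetilde P_{G_{n-1}}(\mathbf{x})+\widetilde P_{G_{n-d-1}}(\mathbf{x})\cdot x_n\cdot\prod_{j=1}^{d}x_{n-j}\Bigl(a_{n-j}-1+\tfrac{1}{x_{n-j}}\Bigr),$$ where each factor $x_{n-j}(a_{n-j}-1+1/x_{n-j})$ means the polynomial $x_{n-j}(a_{n-j}-1)+1$.
   Context: Clique extension of the first kind: for a graph $G$ with vertex set $\{v_1,\dots,v_n\}$ and positive integers $a_1,\dots,a_n$, take complete graphs $K_{a_i}$ on $a_i$ vertices, pairwise disjoint and disjoint from $G$ except that one vertex of $K_{a_i}$ is identified with $v_i$; the graph $G(a_1,\dots,a_n)$ is the union of $G$ and all these cliques (each $K_{a_i}$ is glued to $G$ at $v_i$). For $0\le m\le n$, $G_m$ denotes the subgraph of $G_n=G(a_1,\dots,a_n)$ induced by the vertices of $K_{a_1},\dots,K_{a_m}$ (i.e., the clique extension of the induced subgraph $G[\{v_1,\dots,v_m\}]$ with $a_1,\dots,a_m$; $G_0$ is empty). The reduced independence polynomial of $G_m$ is $\widetilde P_{G_m}(x_1,\dots,x_n)=\sum_{I}\prod_{u\in I}x_{c(u)}$, summed over all independent sets $I$ of $G_m$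 (the empty set contributes $1$), where $c(u)=i$ if $u$ is a vertex of $K_{a_i}$. -}

module Defs where

open import Level using (Level)
open import Data.Nat using (ℕ; zero; suc; _∸_; _≤_; _<_; _<?_; _≤?_)
open import Data.Nat.Properties using () renaming (_≟_ to _≟ℕ_)
open import Data.Fin using (Fin; toℕ)
open import Data.Fin.Properties using (_≟_)
open import Data.List using (List; []; _∷_; _++_; map; concatMap; filter; foldr; allFin)
open import Data.List.Relation.Unary.AllPairs using (AllPairs; allPairs?)
open import Data.Product using (Σ; _,_; proj₁; proj₂; _×_)
open import Data.Sum using (_⊎_)
open import Relation.Nullary using (¬_; Dec; yes; no)
open import Relation.Nullary.Decidable using (_×-dec_; _⊎-dec_; ¬?)
open import Relation.Binary.PropositionalEquality using (_≡_; _≢_)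
open import Relation.Binary using (Decidable; Symmetric; Irreflexive)
open import Algebra.Bundles using (CommutativeRing; Semiring)

-- A finite simple graph on vertices Fin n (vertex v_{i+1} of the paper is i).
record SimpleGraph (n : ℕ) : Set₁ where
  field
    Adj    : Fin n → Fin n → Set
    adj?   : Decidable Adj
    sym    : Symmetric Adj
    irrefl : Irreflexive _≡_ Adj

-- Vertices of the clique extension G(a_1,…,a_n): a pair (i , k) is the k-th
-- vertex of the clique K_{a_i}; the vertex with k = 0 is identified with v_i.
CVertex : (n : ℕ) → (a : Fin n → ℕ) → Set
CVertex n a = Σ (Fin n) (λ i → Fin (a i))

CAdj : ∀ {n} (G : SimpleGraph n) (a : Fin n → ℕ) → CVertex n a → CVertex n a → Set
CAdj G a (i , k) (j , l) =
  (i ≡ j × toℕ k ≢ toℕ l) ⊎ (SimpleGraph.Adj G i j × toℕ k ≡ 0 × toℕ l ≡ 0)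

CAdj? : ∀ {n} (G : SimpleGraph n) (a : Fin n → ℕ) → Decidable (CAdj G a)
CAdj? G a (i , k) (j , l) =
  ((i ≟ j) ×-dec ¬? (toℕ k ≟ℕ toℕ l))
  ⊎-dec (SimpleGraph.adj? G i j ×-dec ((toℕ k ≟ℕ 0) ×-dec (toℕ l ≟ℕ 0)))

cvertices : (n : ℕ) (a : Fin n → ℕ) → List (CVertex n a)
cvertices n a = concatMap (λ i → map (i ,_) (allFin (a i))) (allFin n)

-- Vertices of G_m: those lying in the cliques K_{a_1},…,K_{a_m}.
cverticesUpTo : (n : ℕ) (a : Fin n → ℕ) (m : ℕ) → List (CVertex n a)
cverticesUpTo n a m = filter (λ u → toℕ (proj₁ u) <? m) (cvertices n a)

-- All sub-lists (= all subsets of a duplicate-free list).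
subsets : ∀ {ℓ} {A : Set ℓ} → List A → List (List A)
subsets []       = [] ∷ []
subsets (x ∷ xs) = subsets xs ++ map (x ∷_) (subsets xs)

Independent : ∀ {n} (G : SimpleGraph n) (a : Fin n → ℕ) → List (CVertex n a) → Set
Independent G a = AllPairs (λ u w → ¬ CAdj G a u w)

independent? : ∀ {n} (G : SimpleGraph n) (a : Fin n → ℕ) (I : List (CVertex n a)) → Dec (Independent G a I)
independent? G a = allPairs? (λ u w → ¬? (CAdj? G a u w))

module _ {c ℓ : Level} (R : CommutativeRing c ℓ) where
  open CommutativeRing R

  sumR : List Carrier → Carrier
  sumR = foldr _+_ 0#

  prodR : List Carrier → Carrier
  prodR = foldr _*_ 1#

  -- Reduced independence polynomial of G_m evaluated at x = (x_1,…,x_n):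
  -- sum over independent sets I of G_m of ∏_{u ∈ I} x_{c(u)}.
  redIndPoly : ∀ {n} (G : SimpleGraph n) (a : Fin n → ℕ) (m : ℕ) (x : Fin n → Carrier) → Carrier
  redIndPoly {n} G a m x =
    sumR (map (λ I → prodR (map (λ u → x (proj₁ u)) I))
              (filter (independent? G a) (subsets (cverticesUpTo n a m))))

  natR : ℕ → Carrier
  natR k = k ×ₙ 1#
    where open import Algebra.Definitions.RawSemiring (Semiring.rawSemiring semiring) using () renaming (_×_ to _×ₙ_)

-- Deleting v_n gives P(G_n) = P(G_n − v_n) + x_n P(G_n − N[v_n]). In G_n − v_n the other vertices of
-- K_{a_n} have no edges to G_{n−1}; in G_n − N[v_n] the non-original vertices of the cliques K_{a_{n−j}},
-- 1 ≤ j ≤ d, have no edges to G_{n−d−1} or to one another. Independence polynomials multiply over such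
-- splittings, and a clique on a − 1 vertices contributes 1 + (a − 1) x.
module Submission where

open import Algebra.Bundles using (CommutativeRing; CommutativeMonoid)
import Algebra.Properties.CommutativeSemigroup as CommutativeSemigroupProperties
open import Data.Bool using (Bool; true; false; _∧_; _∨_; not; if_then_else_)
open import Data.Bool.ListAction using (all; any)
open import Data.Bool.Properties
  using (∧-zeroʳ; ∧-identityʳ; ∧-comm; ∧-conicalˡ; ∧-conicalʳ; ∧-inverseʳ; ∨-zeroʳ; not-injective;
         ∧-commutativeMonoid)
open import Data.Empty using (⊥-elim)
open import Data.Fin using (Fin; toℕ; fromℕ; fromℕ<) renaming (suc to fsuc)
open import Data.Fin.Properties using (_≟_; toℕ-injective; toℕ-fromℕ; toℕ-fromℕ<; toℕ≤pred[n]; toℕ<n)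
open import Data.List using (List; []; _∷_; _++_; map; filter; allFin; concatMap; tabulate)
open import Data.List.Membership.Propositional using (_∈_)
open import Data.List.Membership.Propositional.Properties using (∈-map⁻; ∈-map⁺; ∈-allFin; ∈-concatMap⁺)
open import Data.List.Properties using (map-++; map-∘; map-tabulate)
open import Data.List.Relation.Unary.All as All using (All; []; _∷_)
import Data.List.Relation.Unary.All.Properties as All
open import Data.List.Relation.Unary.AllPairs using ([]; _∷_)
import Data.List.Relation.Unary.AllPairs as AllPairs
import Data.List.Relation.Unary.AllPairs.Properties as AllPairs
open import Data.List.Relation.Unary.Any using (here; there)
import Data.List.Relation.Unary.Any as Any
open import Data.List.Relation.Unary.Unique.Propositional using (Unique)
import Data.List.Relation.Unary.Unique.Propositional.Properties as Unique
open import Data.Nat using (ℕ; zero; suc; _∸_; _≤_; _<_; _≤?_; _<?_)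
import Data.Nat.Properties as ℕ
open import Data.Product using (_,_; proj₁; proj₂; _×_)
open import Data.Sum using (_⊎_; inj₁; inj₂)
open import Defs
open import Function.Base using (_∘_)
open import Function.Bundles using (_⇔_; mk⇔; Equivalence)
open import Level using (Level)
open import Relation.Nullary using (¬_; Dec; does; yes; no; contradiction)
open import Relation.Nullary.Decidable using (dec-true; dec-false; does-⇔; ¬?; _×-dec_)
open import Relation.Unary using (Decidable)
import Relation.Binary.PropositionalEquality as ≡
open ≡ using (_≡_)

module ∧ = CommutativeSemigroupProperties (CommutativeMonoid.commutativeSemigroup ∧-commutativeMonoid)

not-∧-∧ : ∀ t o → not (t ∧ o) ∧ t ≡ t ∧ not o
not-∧-∧ true  o = ∧-identityʳ (not o)
not-∧-∧ false o = ≡.refl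

not-∧-∧-not : ∀ t o → not (t ∧ o) ∧ not t ≡ not t
not-∧-∧-not true  o = ∧-zeroʳ (not o)
not-∧-∧-not false o = ≡.refl

module IndependencePolynomial {c ℓ : Level} (R : CommutativeRing c ℓ) where
  open CommutativeRing R
  open import Relation.Binary.Reasoning.Setoid setoid
  module + = CommutativeSemigroupProperties +-commutativeSemigroup
  module * = CommutativeSemigroupProperties *-commutativeSemigroup

  when : Bool → Carrier → Carrier
  when b y = if b then y else 0#

  when-cong : (b : Bool) {y z : Carrier} → y ≈ z → when b y ≈ when b z
  when-cong true  y≈z = y≈z
  when-cong false y≈z = refl

  when-*ˡ : (b : Bool) (k y : Carrier) → when b (k * y) ≈ k * when b y
  when-*ˡ true  k y = refl
  when-*ˡ false k y = sym (zeroʳ k)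

  -- Expanding the deletion recurrence at a vertex x and then at c, or in the other order, gives the same result.
  when-exchange : ∀ A B C D wx wc (bx bc bxc : Bool) →
    (A + when bc (wc * B)) + when bx (wx * (C + when (bc ∧ not bxc) (wc * D)))
      ≈ (A + when bx (wx * C)) + when bc (wc * (B + when (bx ∧ not bxc) (wx * D)))
  when-exchange A B C D wx wc false false bxc = refl
  when-exchange A B C D wx wc false true  bxc =
    trans (+-identityʳ _) (+-cong (sym (+-identityʳ A)) (*-congˡ (sym (+-identityʳ B))))
  when-exchange A B C D wx wc true  false bxc =
    trans (+-cong (+-identityʳ A) (*-congˡ (+-identityʳ C))) (sym (+-identityʳ _))
  when-exchange A B C D wx wc true  true  true =
    trans (+-congˡ (*-congˡ (+-identityʳ C))) (trans (+.xy∙z≈xz∙y A _ _) (+-congˡ (*-congˡ (sym (+-identityʳ B)))))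
  when-exchange A B C D wx wc true  true  false = begin
    (A + wc * B) + wx * (C + wc * D)             ≈⟨ +-congˡ (distribˡ wx C _) ⟩
    (A + wc * B) + (wx * C + wx * (wc * D))      ≈⟨ sym (+-assoc _ _ _) ⟩
    ((A + wc * B) + wx * C) + wx * (wc * D)      ≈⟨ +-cong (+.xy∙z≈xz∙y A _ _) (*.x∙yz≈y∙xz wx wc D) ⟩
    ((A + wx * C) + wc * B) + wc * (wx * D)      ≈⟨ +-assoc _ _ _ ⟩
    (A + wx * C) + (wc * B + wc * (wx * D))      ≈⟨ +-congˡ (sym (distribˡ wc B _)) ⟩
    (A + wx * C) + wc * (B + wx * D)             ∎

  sumR-++ : (xs ys : List Carrier) → sumR R (xs ++ ys) ≈ sumR R xs + sumR R ys
  sumR-++ []       ys = sym (+-identityˡ _)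
  sumR-++ (x ∷ xs) ys = trans (+-congˡ (sumR-++ xs ys)) (sym (+-assoc _ _ _))

  module _ {A : Set} where

    sumR-cong : {f g : A → Carrier} → (∀ u → f u ≈ g u) → (xs : List A) →
                sumR R (map f xs) ≈ sumR R (map g xs)
    sumR-cong f≈g []       = refl
    sumR-cong f≈g (u ∷ xs) = +-cong (f≈g u) (sumR-cong f≈g xs)

    sumR-*ˡ : (k : Carrier) (f : A → Carrier) (xs : List A) →
              sumR R (map (λ u → k * f u) xs) ≈ k * sumR R (map f xs)
    sumR-*ˡ k f []       = sym (zeroʳ k)
    sumR-*ˡ k f (u ∷ xs) = trans (+-congˡ (sumR-*ˡ k f xs)) (sym (distribˡ k _ _))

    sumR-0 : (xs : List A) → sumR R (map (λ _ → 0#) xs) ≈ 0#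
    sumR-0 []       = refl
    sumR-0 (u ∷ xs) = trans (+-congˡ (sumR-0 xs)) (+-identityʳ 0#)

    sumR-when : (b : Bool) (k : Carrier) (f : A → Carrier) (xs : List A) →
                sumR R (map (λ u → when b (k * f u)) xs) ≈ when b (k * sumR R (map f xs))
    sumR-when true  k f xs = sumR-*ˡ k f xs
    sumR-when false k f xs = sumR-0 xs

    sumR-filter : {P : A → Set} (P? : Decidable P) (f : A → Carrier) (xs : List A) →
                  sumR R (map f (filter P? xs)) ≈ sumR R (map (λ u → when (does (P? u)) (f u)) xs)
    sumR-filter P? f [] = refl
    sumR-filter P? f (u ∷ xs) with does (P? u)
    ... | true  = +-congˡ (sumR-filter P? f xs)
    ... | false = trans (sumR-filter P? f xs) (sym (+-identityˡ _))

  sumR-concatMap : {A B : Set} (f : B → List A) (h : A → Carrier) (is : List B) →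
                   sumR R (map h (concatMap f is)) ≈ sumR R (map (λ i → sumR R (map h (f i))) is)
  sumR-concatMap f h []       = refl
  sumR-concatMap f h (i ∷ is) = begin
    sumR R (map h (f i ++ concatMap f is))               ≡⟨ ≡.cong (sumR R) (map-++ h (f i) (concatMap f is)) ⟩
    sumR R (map h (f i) ++ map h (concatMap f is))        ≈⟨ sumR-++ (map h (f i)) _ ⟩
    sumR R (map h (f i)) + sumR R (map h (concatMap f is)) ≈⟨ +-congˡ (sumR-concatMap f h is) ⟩
    sumR R (map h (f i)) + sumR R (map (λ i → sumR R (map h (f i))) is) ∎

  sumR-const : (y : Carrier) (m : ℕ) → sumR R (tabulate {n = m} (λ _ → y)) ≈ y * natR R m
  sumR-const y zero    = sym (zeroʳ y)
  sumR-const y (suc m) = begin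
    y + sumR R (tabulate {n = m} (λ _ → y)) ≈⟨ +-cong (sym (*-identityʳ y)) (sumR-const y m) ⟩
    y * 1# + y * natR R m                   ≈⟨ sym (distribˡ y 1# (natR R m)) ⟩
    y * natR R (suc m)                      ∎

  -- For m = 0 both sides vanish, the right one because 0 ∸ 1 = 0.
  sumR-nonzero : (y : Carrier) (m : ℕ) →
                 sumR R (map (λ j → when (not (does (toℕ j ℕ.≟ 0))) y) (allFin m)) ≈ y * natR R (m ∸ 1)
  sumR-nonzero y zero    = sym (zeroʳ y)
  sumR-nonzero y (suc m) = trans (+-identityˡ _)
    (trans (reflexive (≡.cong (sumR R) (map-tabulate {n = m} fsuc (λ (j : Fin (suc m)) → when (not (does (toℕ j ℕ.≟ 0))) y))))
           (sumR-const y m))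

  sumR-atIndex : ∀ {n} (k : Fin n) (y : Carrier) (is : List (Fin n)) → Unique is → k ∈ is →
                 sumR R (map (λ i → when (does (i ≟ k)) y) is) ≈ y
  sumR-atIndex k y (k ∷ is) (k∉is ∷ _) (here ≡.refl) = begin
    when (does (k ≟ k)) y + sumR R (map (λ i → when (does (i ≟ k)) y) is)
      ≡⟨ ≡.cong (λ b → when b y + sumR R (map (λ i → when (does (i ≟ k)) y) is)) (dec-true (k ≟ k) ≡.refl) ⟩
    y + sumR R (map (λ i → when (does (i ≟ k)) y) is)  ≈⟨ +-congˡ (absent is k∉is) ⟩
    y + 0#                                              ≈⟨ +-identityʳ y ⟩
    y                                                   ∎
    where
    absent : (js : List (Fin _)) → All (λ j → ¬ k ≡ j) js → sumR R (map (λ i → when (does (i ≟ k)) y) js) ≈ 0#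
    absent []       []           = refl
    absent (j ∷ js) (k≢j ∷ k∉js) =
      trans (+-cong (reflexive (≡.cong (λ b → when b y) (dec-false (j ≟ k) (λ j≡k → k≢j (≡.sym j≡k)))))
                    (absent js k∉js))
            (+-identityʳ 0#)
  sumR-atIndex k y (i ∷ is) (i∉is ∷ uniq) (there k∈is) = begin
    when (does (i ≟ k)) y + sumR R (map (λ i → when (does (i ≟ k)) y) is)
      ≡⟨ ≡.cong (λ b → when b y + sumR R (map (λ i → when (does (i ≟ k)) y) is))
                (dec-false (i ≟ k) (All.lookup i∉is k∈is)) ⟩
    0# + sumR R (map (λ i → when (does (i ≟ k)) y) is)  ≈⟨ +-identityˡ _ ⟩
    sumR R (map (λ i → when (does (i ≟ k)) y) is)       ≈⟨ sumR-atIndex k y is uniq k∈is ⟩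
    y                                                    ∎

  module Weighted {V : Set} (adj : V → V → Bool) (adj-sym : ∀ u v → adj u v ≡ adj v u)
                  (w : V → Carrier) where

    infixr 6 _∧̇_

    _∧̇_ : (V → Bool) → (V → Bool) → V → Bool
    (p ∧̇ q) u = p u ∧ q u

    ¬̇_ : (V → Bool) → V → Bool
    (¬̇ p) u = not (p u)

    nonadj : V → V → Bool
    nonadj u v = not (adj u v)

    independentᵇ : List V → Bool
    independentᵇ []      = true
    independentᵇ (u ∷ K) = all (nonadj u) K ∧ independentᵇ K

    weight : List V → Carrier
    weight K = prodR R (map w K)

    indTerm : (V → Bool) → List V → Carrier
    indTerm p K = when (independentᵇ K ∧ all p K) (weight K)

    -- The independence polynomial of the subgraph induced on the entries of L satisfying p;
    -- vertex sets are Boolean predicates throughout.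
    indPoly : List V → (V → Bool) → Carrier
    indPoly L p = sumR R (map (indTerm p) (subsets L))

    all-∧̇ : (p q : V → Bool) (K : List V) → all (p ∧̇ q) K ≡ all p K ∧ all q K
    all-∧̇ p q []      = ≡.refl
    all-∧̇ p q (u ∷ K) with p u | q u
    ... | true  | true  = all-∧̇ p q K
    ... | true  | false = ≡.sym (∧-zeroʳ (all p K))
    ... | false | _     = ≡.refl

    indTerm-∷ : (p : V → Bool) (u : V) (K : List V) →
                indTerm p (u ∷ K) ≈ when (p u) (w u * indTerm (p ∧̇ nonadj u) K)
    indTerm-∷ p u K with p u
    ... | false rewrite ∧-zeroʳ (all (nonadj u) K ∧ independentᵇ K) = refl
    ... | true  = begin
      when ((all (nonadj u) K ∧ independentᵇ K) ∧ all p K) (w u * weight K)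
        ≡⟨ ≡.cong (λ b → when b (w u * weight K)) (rearrange (all (nonadj u) K) (independentᵇ K) (all p K)) ⟩
      when (independentᵇ K ∧ all p K ∧ all (nonadj u) K) (w u * weight K)
        ≡⟨ ≡.cong (λ b → when (independentᵇ K ∧ b) (w u * weight K)) (≡.sym (all-∧̇ p (nonadj u) K)) ⟩
      when (independentᵇ K ∧ all (p ∧̇ nonadj u) K) (w u * weight K)
        ≈⟨ when-*ˡ _ (w u) (weight K) ⟩
      w u * indTerm (p ∧̇ nonadj u) K ∎
      where
      rearrange : ∀ a b c → (a ∧ b) ∧ c ≡ b ∧ c ∧ a
      rearrange a b c = ≡.trans (∧.xy∙z≈y∙xz a b c) (≡.cong (b ∧_) (∧-comm a c))

    indPoly-[] : (p : V → Bool) → indPoly [] p ≈ 1#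
    indPoly-[] p = +-identityʳ 1#

    indPoly-∷ : (u : V) (L : List V) (p : V → Bool) →
                indPoly (u ∷ L) p ≈ indPoly L p + when (p u) (w u * indPoly L (p ∧̇ nonadj u))
    indPoly-∷ u L p = begin
      sumR R (map (indTerm p) (subsets L ++ map (u ∷_) (subsets L)))
        ≡⟨ ≡.cong (sumR R) (map-++ (indTerm p) (subsets L) _) ⟩
      sumR R (map (indTerm p) (subsets L) ++ map (indTerm p) (map (u ∷_) (subsets L)))
        ≈⟨ sumR-++ (map (indTerm p) (subsets L)) _ ⟩
      indPoly L p + sumR R (map (indTerm p) (map (u ∷_) (subsets L)))
        ≡⟨ ≡.cong (λ ts → indPoly L p + sumR R ts) (≡.sym (map-∘ (subsets L))) ⟩
      indPoly L p + sumR R (map (λ K → indTerm p (u ∷ K)) (subsets L))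
        ≈⟨ +-congˡ (sumR-cong (indTerm-∷ p u) (subsets L)) ⟩
      indPoly L p + sumR R (map (λ K → when (p u) (w u * indTerm (p ∧̇ nonadj u) K)) (subsets L))
        ≈⟨ +-congˡ (sumR-when (p u) (w u) _ (subsets L)) ⟩
      indPoly L p + when (p u) (w u * indPoly L (p ∧̇ nonadj u)) ∎

    indPoly-∷-false : (u : V) (L : List V) (p : V → Bool) → p u ≡ false → indPoly (u ∷ L) p ≈ indPoly L p
    indPoly-∷-false u L p pu≡false = begin
      indPoly (u ∷ L) p                                             ≈⟨ indPoly-∷ u L p ⟩
      indPoly L p + when (p u) (w u * indPoly L (p ∧̇ nonadj u))
        ≡⟨ ≡.cong (λ b → indPoly L p + when b (w u * indPoly L (p ∧̇ nonadj u))) pu≡false ⟩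
      indPoly L p + 0#                                              ≈⟨ +-identityʳ _ ⟩
      indPoly L p                                                   ∎

    indPoly-congᴸ : (L : List V) {p q : V → Bool} → All (λ u → p u ≡ q u) L → indPoly L p ≈ indPoly L q
    indPoly-congᴸ []      {p} {q} []         = trans (indPoly-[] p) (sym (indPoly-[] q))
    indPoly-congᴸ (u ∷ L) {p} {q} (pu≡qu ∷ eqs) = begin
      indPoly (u ∷ L) p                                            ≈⟨ indPoly-∷ u L p ⟩
      indPoly L p + when (p u) (w u * indPoly L (p ∧̇ nonadj u))  ≈⟨ +-cong (indPoly-congᴸ L eqs) (branch pu≡qu) ⟩
      indPoly L q + when (q u) (w u * indPoly L (q ∧̇ nonadj u))  ≈⟨ sym (indPoly-∷ u L q) ⟩
      indPoly (u ∷ L) q                                            ∎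
      where
      branch : p u ≡ q u → when (p u) (w u * indPoly L (p ∧̇ nonadj u)) ≈ when (q u) (w u * indPoly L (q ∧̇ nonadj u))
      branch eq rewrite eq =
        when-cong (q u) (*-congˡ (indPoly-congᴸ L (All.map (λ {v} e → ≡.cong (_∧ nonadj u v) e) eqs)))

    indPoly-cong : (L : List V) {p q : V → Bool} → (∀ u → p u ≡ q u) → indPoly L p ≈ indPoly L q
    indPoly-cong L p≗q = indPoly-congᴸ L (All.tabulate (λ {u} _ → p≗q u))

    indPoly-false : (L : List V) (p : V → Bool) → All (λ u → p u ≡ false) L → indPoly L p ≈ 1#
    indPoly-false []      p []           = indPoly-[] p
    indPoly-false (u ∷ L) p (pu≡false ∷ rest) =
      trans (indPoly-∷-false u L p pu≡false) (indPoly-false L p rest)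

    nonadj-redundant : (u : V) (p : V → Bool) → (∀ v → p v ≡ true → adj u v ≡ false) →
                       ∀ v → (p ∧̇ nonadj u) v ≡ p v
    nonadj-redundant u p p⇒nonadj v with p v in pv
    ... | false = ≡.refl
    ... | true  rewrite p⇒nonadj v pv = ≡.refl

    indPoly-swap : (L : List V) (p q r : V → Bool) → indPoly L ((p ∧̇ q) ∧̇ r) ≈ indPoly L ((p ∧̇ r) ∧̇ q)
    indPoly-swap L p q r = indPoly-cong L (λ v → ∧.xy∙z≈xz∙y (p v) (q v) (r v))

    NoEdgesAcross : (V → Bool) → (V → Bool) → Set
    NoEdgesAcross p s = ∀ u v → p u ≡ true → p v ≡ true → s u ≡ true → s v ≡ false → adj u v ≡ false

    NoEdgesAcross-∧̇ : ∀ {p} q {s} → NoEdgesAcross p s → NoEdgesAcross (p ∧̇ q) s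
    NoEdgesAcross-∧̇ {p} q sep u v pqu pqv = sep u v (∧-conicalˡ (p u) (q u) pqu) (∧-conicalˡ (p v) (q v) pqv)

    indPoly-split : (L : List V) (p s : V → Bool) → NoEdgesAcross p s →
                    indPoly L p ≈ indPoly L (p ∧̇ s) * indPoly L (p ∧̇ ¬̇ s)
    indPoly-split []      p s sep =
      trans (indPoly-[] p) (sym (trans (*-cong (indPoly-[] (p ∧̇ s)) (indPoly-[] (p ∧̇ ¬̇ s))) (*-identityˡ 1#)))
    indPoly-split (u ∷ L) p s sep = begin
      indPoly (u ∷ L) p                                          ≈⟨ indPoly-∷ u L p ⟩
      indPoly L p + when (p u) (w u * indPoly L (p ∧̇ nonadj u))
        ≈⟨ +-cong (indPoly-split L p s sep)
                  (when-cong (p u) (*-congˡ (indPoly-split L (p ∧̇ nonadj u) s (NoEdgesAcross-∧̇ (nonadj u) sep)))) ⟩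
      A * B + when (p u) (w u * (E * F))                         ≈⟨ cases (p u) (s u) ≡.refl ≡.refl ⟩
      (A + when (p u ∧ s u) (w u * C)) * (B + when (p u ∧ not (s u)) (w u * D))
        ≈⟨ sym (*-cong (indPoly-∷ u L (p ∧̇ s)) (indPoly-∷ u L (p ∧̇ ¬̇ s))) ⟩
      indPoly (u ∷ L) (p ∧̇ s) * indPoly (u ∷ L) (p ∧̇ ¬̇ s)      ∎
      where
      A = indPoly L (p ∧̇ s)
      B = indPoly L (p ∧̇ ¬̇ s)
      C = indPoly L ((p ∧̇ s) ∧̇ nonadj u)
      D = indPoly L ((p ∧̇ ¬̇ s) ∧̇ nonadj u)
      E = indPoly L ((p ∧̇ nonadj u) ∧̇ s)
      F = indPoly L ((p ∧̇ nonadj u) ∧̇ ¬̇ s)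

      -- A vertex on one side of the cut is non-adjacent to the whole other side.
      E≈A : p u ≡ true → s u ≡ false → E ≈ A
      E≈A pu su = trans (indPoly-swap L p (nonadj u) s) (indPoly-cong L (nonadj-redundant u (p ∧̇ s) u↮))
        where
        u↮ : ∀ v → (p ∧̇ s) v ≡ true → adj u v ≡ false
        u↮ v psv = ≡.trans (adj-sym u v)
                     (sep v u (∧-conicalˡ (p v) (s v) psv) pu (∧-conicalʳ (p v) (s v) psv) su)

      F≈B : p u ≡ true → s u ≡ true → F ≈ B
      F≈B pu su = trans (indPoly-swap L p (nonadj u) (¬̇ s)) (indPoly-cong L (nonadj-redundant u (p ∧̇ ¬̇ s) u↮))
        where
        u↮ : ∀ v → (p ∧̇ ¬̇ s) v ≡ true → adj u v ≡ false
        u↮ v psv = sep u v pu (∧-conicalˡ (p v) _ psv) su (not-injective (∧-conicalʳ (p v) _ psv))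

      cases : (bp bs : Bool) → p u ≡ bp → s u ≡ bs →
              A * B + when bp (w u * (E * F)) ≈ (A + when (bp ∧ bs) (w u * C)) * (B + when (bp ∧ not bs) (w u * D))
      cases false bs _ _ = trans (+-identityʳ _) (sym (*-cong (+-identityʳ A) (+-identityʳ B)))
      cases true true pu su = begin
        A * B + w u * (E * F)       ≈⟨ +-congˡ (*-congˡ (*-cong (indPoly-swap L p (nonadj u) s) (F≈B pu su))) ⟩
        A * B + w u * (C * B)       ≈⟨ +-congˡ (sym (*-assoc _ _ _)) ⟩
        A * B + (w u * C) * B       ≈⟨ sym (distribʳ B A _) ⟩
        (A + w u * C) * B           ≈⟨ *-congˡ (sym (+-identityʳ B)) ⟩
        (A + w u * C) * (B + 0#)    ∎
      cases true false pu su = begin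
        A * B + w u * (E * F)       ≈⟨ +-congˡ (*-congˡ (*-cong (E≈A pu su) (indPoly-swap L p (nonadj u) (¬̇ s)))) ⟩
        A * B + w u * (A * D)       ≈⟨ +-congˡ (*.x∙yz≈y∙xz _ _ _) ⟩
        A * B + A * (w u * D)       ≈⟨ sym (distribˡ A B _) ⟩
        A * (B + w u * D)           ≈⟨ *-congʳ (sym (+-identityʳ A)) ⟩
        (A + 0#) * (B + w u * D)    ∎

    ¬̇-redundant : (L : List V) (q t : V → Bool) → All (λ v → t v ≡ false) L →
                  indPoly L (q ∧̇ ¬̇ t) ≈ indPoly L q
    ¬̇-redundant L q t t≡false =
      indPoly-congᴸ L (All.map (λ {v} tv → ≡.trans (≡.cong (λ b → q v ∧ not b) tv) (∧-identityʳ (q v))) t≡false)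

    indicator-false : ∀ {t : V → Bool} {c} → (∀ v → t v ≡ true → v ≡ c) → ∀ {v} → ¬ c ≡ v → t v ≡ false
    indicator-false {t} t⇒c {v} c≢v with t v in tv
    ... | true  = ⊥-elim (c≢v (≡.sym (t⇒c v tv)))
    ... | false = ≡.refl

    indPoly-delete : (L : List V) (p t : V → Bool) {c : V} → Unique L → c ∈ L →
      t c ≡ true → (∀ v → t v ≡ true → v ≡ c) →
      indPoly L p ≈ indPoly L (p ∧̇ ¬̇ t) + when (p c) (w c * indPoly L ((p ∧̇ ¬̇ t) ∧̇ nonadj c))
    indPoly-delete (c ∷ L) p t {c} (c∉L ∷ _) (here ≡.refl) tc t⇒c = begin
      indPoly (c ∷ L) p                                                      ≈⟨ indPoly-∷ c L p ⟩
      indPoly L p + when (p c) (w c * indPoly L (p ∧̇ nonadj c))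
        ≈⟨ +-cong (sym (¬̇-redundant L p t t≡false))
                  (when-cong (p c) (*-congˡ (sym (trans (indPoly-swap L p (¬̇ t) (nonadj c))
                                                        (¬̇-redundant L (p ∧̇ nonadj c) t t≡false))))) ⟩
      indPoly L (p ∧̇ ¬̇ t) + when (p c) (w c * indPoly L ((p ∧̇ ¬̇ t) ∧̇ nonadj c))
        ≈⟨ sym (+-cong (indPoly-∷-false c L _ pt̄c) (when-cong (p c) (*-congˡ (indPoly-∷-false c L _ pt̄c′)))) ⟩
      indPoly (c ∷ L) (p ∧̇ ¬̇ t) + when (p c) (w c * indPoly (c ∷ L) ((p ∧̇ ¬̇ t) ∧̇ nonadj c)) ∎
      where
      t≡false : All (λ v → t v ≡ false) L
      t≡false = All.map (indicator-false t⇒c) c∉L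
      pt̄c : (p ∧̇ ¬̇ t) c ≡ false
      pt̄c = ≡.trans (≡.cong (λ b → p c ∧ not b) tc) (∧-zeroʳ (p c))
      pt̄c′ : ((p ∧̇ ¬̇ t) ∧̇ nonadj c) c ≡ false
      pt̄c′ = ≡.cong (_∧ nonadj c c) pt̄c
    indPoly-delete (x ∷ L) p t {c} (x∉L ∷ uniq) (there c∈L) tc t⇒c = begin
      indPoly (x ∷ L) p                                      ≈⟨ indPoly-∷ x L p ⟩
      indPoly L p + when (p x) (w x * indPoly L (p ∧̇ nonadj x))
        ≈⟨ +-cong (indPoly-delete L p t uniq c∈L tc t⇒c)
                  (when-cong (p x) (*-congˡ (indPoly-delete L (p ∧̇ nonadj x) t uniq c∈L tc t⇒c))) ⟩
      (A + when (p c) (w c * B)) + when (p x) (w x * (C′ + when (p c ∧ not (adj x c)) (w c * D′)))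
        ≈⟨ +-congˡ (when-cong (p x) (*-congˡ (+-cong C′≈C (when-cong (p c ∧ not (adj x c)) (*-congˡ D′≈D))))) ⟩
      (A + when (p c) (w c * B)) + when (p x) (w x * (C + when (p c ∧ not (adj x c)) (w c * D)))
        ≈⟨ when-exchange A B C D (w x) (w c) (p x) (p c) (adj x c) ⟩
      (A + when (p x) (w x * C)) + when (p c) (w c * (B + when (p x ∧ not (adj x c)) (w x * D)))
        ≡⟨ ≡.cong₂ (λ b b′ → (A + when b (w x * C)) + when (p c) (w c * (B + when b′ (w x * D))))
                   px≡pt̄x (≡.cong₂ _∧_ px≡pt̄x (≡.cong not (adj-sym x c))) ⟩
      (A + when ((p ∧̇ ¬̇ t) x) (w x * C)) + when (p c) (w c * (B + when (((p ∧̇ ¬̇ t) ∧̇ nonadj c) x) (w x * D)))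
        ≈⟨ sym (+-cong (indPoly-∷ x L (p ∧̇ ¬̇ t))
                       (when-cong (p c) (*-congˡ (indPoly-∷ x L ((p ∧̇ ¬̇ t) ∧̇ nonadj c))))) ⟩
      indPoly (x ∷ L) (p ∧̇ ¬̇ t) + when (p c) (w c * indPoly (x ∷ L) ((p ∧̇ ¬̇ t) ∧̇ nonadj c)) ∎
      where
      A  = indPoly L (p ∧̇ ¬̇ t)
      B  = indPoly L ((p ∧̇ ¬̇ t) ∧̇ nonadj c)
      C  = indPoly L ((p ∧̇ ¬̇ t) ∧̇ nonadj x)
      D  = indPoly L (((p ∧̇ ¬̇ t) ∧̇ nonadj c) ∧̇ nonadj x)
      C′ = indPoly L ((p ∧̇ nonadj x) ∧̇ ¬̇ t)
      D′ = indPoly L (((p ∧̇ nonadj x) ∧̇ ¬̇ t) ∧̇ nonadj c)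
      C′≈C : C′ ≈ C
      C′≈C = indPoly-swap L p (nonadj x) (¬̇ t)
      D′≈D : D′ ≈ D
      D′≈D = indPoly-cong L (λ v → ≡.trans (≡.cong (_∧ nonadj c v) (∧.xy∙z≈xz∙y (p v) (nonadj x v) (not (t v))))
                                           (∧.xy∙z≈xz∙y (p v ∧ not (t v)) (nonadj x v) (nonadj c v)))
      tx≡false : t x ≡ false
      tx≡false = indicator-false t⇒c (λ c≡x → All.lookup x∉L c∈L (≡.sym c≡x))
      px≡pt̄x : p x ≡ (p ∧̇ ¬̇ t) x
      px≡pt̄x = ≡.sym (≡.trans (≡.cong (λ b → p x ∧ not b) tx≡false) (∧-identityʳ (p x)))

    IsClique : (V → Bool) → Set
    IsClique p = ∀ u v → p u ≡ true → p v ≡ true → ¬ u ≡ v → adj u v ≡ true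

    indPoly-clique : (L : List V) (p : V → Bool) → Unique L → IsClique p →
                     indPoly L p ≈ 1# + sumR R (map (λ u → when (p u) (w u)) L)
    indPoly-clique []      p _ clique = trans (indPoly-[] p) (sym (+-identityʳ 1#))
    indPoly-clique (x ∷ L) p (x∉L ∷ uniq) clique =
      trans (indPoly-∷ x L p) (trans (+-congʳ (indPoly-clique L p uniq clique)) (step (p x) ≡.refl))
      where
      S = sumR R (map (λ u → when (p u) (w u)) L)
      step : (b : Bool) → p x ≡ b → (1# + S) + when b (w x * indPoly L (p ∧̇ nonadj x)) ≈ 1# + (when b (w x) + S)
      step false _  = trans (+-identityʳ _) (+-congˡ (sym (+-identityˡ S)))
      step true  px = begin
        (1# + S) + w x * indPoly L (p ∧̇ nonadj x) ≈⟨ +-congˡ (*-congˡ (indPoly-false L _ (All.map (λ {v} → x↔ v) x∉L))) ⟩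
        (1# + S) + w x * 1#                        ≈⟨ +-congˡ (*-identityʳ _) ⟩
        (1# + S) + w x                             ≈⟨ +-assoc _ _ _ ⟩
        1# + (S + w x)                             ≈⟨ +-congˡ (+-comm S _) ⟩
        1# + (w x + S)                             ∎
        where
        x↔ : ∀ v → ¬ x ≡ v → (p ∧̇ nonadj x) v ≡ false
        x↔ v x≢v with p v in pv
        ... | false = ≡.refl
        ... | true rewrite clique x v px pv x≢v = ≡.refl

    indPoly-filter : {P : V → Set} (P? : Decidable P) (L : List V) (p : V → Bool) →
                     indPoly (filter P? L) p ≈ indPoly L (p ∧̇ (λ u → does (P? u)))
    indPoly-filter P? []      p = refl
    indPoly-filter P? (x ∷ L) p with does (P? x) in Px
    ... | true  = begin
      indPoly (x ∷ filter P? L) p                                     ≈⟨ indPoly-∷ x (filter P? L) p ⟩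
      indPoly (filter P? L) p + when (p x) (w x * indPoly (filter P? L) (p ∧̇ nonadj x))
        ≈⟨ +-cong (indPoly-filter P? L p)
                  (when-cong (p x) (*-congˡ (trans (indPoly-filter P? L _) (indPoly-swap L p (nonadj x) _)))) ⟩
      indPoly L q + when (p x) (w x * indPoly L (q ∧̇ nonadj x))
        ≡⟨ ≡.cong (λ b → indPoly L q + when b (w x * indPoly L (q ∧̇ nonadj x)))
                  (≡.sym (≡.trans (≡.cong (p x ∧_) Px) (∧-identityʳ (p x)))) ⟩
      indPoly L q + when (q x) (w x * indPoly L (q ∧̇ nonadj x))       ≈⟨ sym (indPoly-∷ x L q) ⟩
      indPoly (x ∷ L) q                                                ∎
      where q = p ∧̇ (λ u → does (P? u))
    ... | false = trans (indPoly-filter P? L p)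
                        (sym (indPoly-∷-false x L _ (≡.trans (≡.cong (p x ∧_) Px) (∧-zeroʳ (p x)))))

module CliqueExtension {c ℓ : Level} (R : CommutativeRing c ℓ) {n : ℕ} (G : SimpleGraph n)
                       (a : Fin n → ℕ) (x : Fin n → CommutativeRing.Carrier R) where
  open CommutativeRing R
  open IndependencePolynomial R
  open import Relation.Binary.Reasoning.Setoid setoid

  V : Set
  V = CVertex n a

  adj : V → V → Bool
  adj u v = does (CAdj? G a u v)

  CAdj-sym : ∀ u v → CAdj G a u v → CAdj G a v u
  CAdj-sym (i , k) (j , l) (inj₁ (i≡j , k≢l))        = inj₁ (≡.sym i≡j , λ l≡k → k≢l (≡.sym l≡k))
  CAdj-sym (i , k) (j , l) (inj₂ (ij∈G , k≡0 , l≡0)) = inj₂ (SimpleGraph.sym G ij∈G , l≡0 , k≡0)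

  adj-sym : ∀ u v → adj u v ≡ adj v u
  adj-sym u v = does-⇔ (mk⇔ (CAdj-sym u v) (CAdj-sym v u)) (CAdj? G a u v) (CAdj? G a v u)

  open Weighted adj adj-sym (λ u → x (proj₁ u)) public

  vertices : List V
  vertices = cvertices n a

  clique : Fin n → List V
  clique i = map (i ,_) (allFin (a i))

  inG : ℕ → V → Bool
  inG m u = does (toℕ (proj₁ u) <? m)

  original : V → Bool
  original u = does (toℕ (proj₂ u) ℕ.≟ 0)

  atIndex : Fin n → Fin n → Bool
  atIndex k i = does (i ≟ k)

  inClique : Fin n → V → Bool
  inClique k u = atIndex k (proj₁ u)

  onCliques : (Fin n → Bool) → V → Bool
  onCliques g u = g (proj₁ u) ∧ not (original u)

  cliqueFactor : Fin n → Carrier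
  cliqueFactor k = x k * natR R (a k ∸ 1) + 1#

  independent?≡independentᵇ : (K : List V) → does (independent? G a K) ≡ independentᵇ K
  independent?≡independentᵇ []      = ≡.refl
  independent?≡independentᵇ (u ∷ K) = ≡.cong₂ _∧_ (all?≡all K) (independent?≡independentᵇ K)
    where
    all?≡all : (K : List V) → does (All.all? (λ v → ¬? (CAdj? G a u v)) K) ≡ all (nonadj u) K
    all?≡all []      = ≡.refl
    all?≡all (v ∷ K) = ≡.cong (nonadj u v ∧_) (all?≡all K)

  redIndPoly≈indPoly : (m : ℕ) → redIndPoly R G a m x ≈ indPoly vertices (inG m)
  redIndPoly≈indPoly m = begin
    redIndPoly R G a m x
      ≈⟨ sumR-filter (independent? G a) weight (subsets L) ⟩
    sumR R (map (λ K → when (does (independent? G a K)) (weight K)) (subsets L))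
      ≡⟨ ≡.cong (sumR R) (map-cong-≡ (subsets L)) ⟩
    indPoly L (λ _ → true)
      ≈⟨ indPoly-filter (λ u → toℕ (proj₁ u) <? m) vertices (λ _ → true) ⟩
    indPoly vertices (inG m) ∎
    where
    L = cverticesUpTo n a m
    all-true : (K : List V) → all (λ _ → true) K ≡ true
    all-true []      = ≡.refl
    all-true (_ ∷ K) = all-true K
    map-cong-≡ : (Ks : List (List V)) →
                 map (λ K → when (does (independent? G a K)) (weight K)) Ks ≡ map (indTerm (λ _ → true)) Ks
    map-cong-≡ []       = ≡.refl
    map-cong-≡ (K ∷ Ks) = ≡.cong₂ _∷_ (≡.cong (λ b → when b (weight K)) indep≡) (map-cong-≡ Ks)
      where
      indep≡ : does (independent? G a K) ≡ independentᵇ K ∧ all (λ _ → true) K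
      indep≡ = ≡.trans (independent?≡independentᵇ K)
                       (≡.sym (≡.trans (≡.cong (independentᵇ K ∧_) (all-true K)) (∧-identityʳ _)))

  ∈-clique : ∀ {v i} → v ∈ clique i → proj₁ v ≡ i
  ∈-clique {v} {i} v∈ with ∈-map⁻ (i ,_) v∈
  ... | _ , _ , ≡.refl = ≡.refl

  ∈-vertices : (v : V) → v ∈ vertices
  ∈-vertices (i , k) = ∈-concatMap⁺ clique (Any.map (λ { ≡.refl → ∈-map⁺ (i ,_) (∈-allFin k) }) (∈-allFin i))

  vertices-unique : Unique vertices
  vertices-unique = Unique.concat⁺ (All.map⁺ (All.tabulate (λ {i} _ → clique-unique i)))
                                   (AllPairs.map⁺ (AllPairs.map cliques-disjoint (Unique.allFin⁺ n)))
    where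
    clique-unique : (i : Fin n) → Unique (clique i)
    clique-unique i = Unique.map⁺ (λ { ≡.refl → ≡.refl }) (Unique.allFin⁺ (a i))
    cliques-disjoint : ∀ {i j} → ¬ i ≡ j → ∀ {v} → ¬ (v ∈ clique i × v ∈ clique j)
    cliques-disjoint i≢j (v∈i , v∈j) = i≢j (≡.trans (≡.sym (∈-clique v∈i)) (∈-clique v∈j))

  clique-weight : (k : Fin n) →
    sumR R (map (λ u → when (onCliques (atIndex k) u) (x (proj₁ u))) vertices) ≈ x k * natR R (a k ∸ 1)
  clique-weight k = begin
    sumR R (map h vertices)                                ≈⟨ sumR-concatMap clique h (allFin n) ⟩
    sumR R (map (λ i → sumR R (map h (clique i))) (allFin n)) ≈⟨ sumR-cong inner (allFin n) ⟩
    sumR R (map (λ i → when (does (i ≟ k)) y) (allFin n))   ≈⟨ sumR-atIndex k y (allFin n) (Unique.allFin⁺ n) (∈-allFin k) ⟩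
    y                                                        ∎
    where
    h : V → Carrier
    h u = when (onCliques (atIndex k) u) (x (proj₁ u))
    y = x k * natR R (a k ∸ 1)
    inner : (i : Fin n) → sumR R (map h (clique i)) ≈ when (does (i ≟ k)) y
    inner i = trans (reflexive (≡.cong (sumR R) (≡.sym (map-∘ (allFin (a i)))))) (by-index (i ≟ k))
      where
      by-index : (i≟k : Dec (i ≡ k)) →
        sumR R (map (λ j → when (does i≟k ∧ not (original (i , j))) (x i)) (allFin (a i))) ≈ when (does i≟k) y
      by-index (yes ≡.refl) = sumR-nonzero (x i) (a i)
      by-index (no _)       = sumR-0 (allFin (a i))

  adj-across-cliques : ∀ u v → ¬ proj₁ u ≡ proj₁ v → original u ≡ false → adj u v ≡ false
  adj-across-cliques u v i≢j u-nonoriginal = dec-false (CAdj? G a u v) ¬adj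
    where
    ¬adj : ¬ CAdj G a u v
    ¬adj (inj₁ (i≡j , _))     = i≢j i≡j
    ¬adj (inj₂ (_ , k≡0 , _)) = contradiction (≡.trans (≡.sym (dec-true (_ ℕ.≟ 0) k≡0)) u-nonoriginal) λ ()

  adj-within-clique : ∀ u v → proj₁ u ≡ proj₁ v → ¬ u ≡ v → adj u v ≡ true
  adj-within-clique (i , k) (i , l) ≡.refl u≢v =
    dec-true (CAdj? G a (i , k) (i , l)) (inj₁ (≡.refl , λ k≡l → u≢v (≡.cong (i ,_) (toℕ-injective k≡l))))

  NoEdgesAcross-index : (p : V → Bool) (s : Fin n → Bool) →
    (∀ u → p u ≡ true → s (proj₁ u) ≡ true → original u ≡ false) → NoEdgesAcross p (s ∘ proj₁)
  NoEdgesAcross-index p s nonoriginal u v pu _ su sv =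
    adj-across-cliques u v (λ i≡j → contradiction (≡.trans (≡.sym su) (≡.trans (≡.cong s i≡j) sv)) λ ())
                       (nonoriginal u pu su)

  indPoly-clique-nonoriginal : (k : Fin n) → indPoly vertices (onCliques (atIndex k)) ≈ cliqueFactor k
  indPoly-clique-nonoriginal k = begin
    indPoly vertices (onCliques (atIndex k))
      ≈⟨ indPoly-clique vertices _ vertices-unique is-clique ⟩
    1# + sumR R (map (λ u → when (onCliques (atIndex k) u) (x (proj₁ u))) vertices)
      ≈⟨ +-congˡ (clique-weight k) ⟩
    1# + x k * natR R (a k ∸ 1)
      ≈⟨ +-comm _ _ ⟩
    cliqueFactor k ∎
    where
    is-clique : IsClique (onCliques (atIndex k))
    is-clique u v pu pv = adj-within-clique u v (≡.trans (index u pu) (≡.sym (index v pv)))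
      where
      index : ∀ w → onCliques (atIndex k) w ≡ true → proj₁ w ≡ k
      index w pw with proj₁ w ≟ k
      ... | yes i≡k = i≡k
      ... | no  _   = contradiction pw λ ()

  onCliques-nonoriginal : ∀ g u → onCliques g u ≡ true → original u ≡ false
  onCliques-nonoriginal g u gu = not-injective (∧-conicalʳ (g (proj₁ u)) _ gu)

  listed : List (Fin n) → Fin n → Bool
  listed ks i = any (λ k → atIndex k i) ks

  listed-∉ : ∀ {i} ks → All (λ k → ¬ i ≡ k) ks → listed ks i ≡ false
  listed-∉ []       []           = ≡.refl
  listed-∉ (k ∷ ks) (i≢k ∷ i∉ks) = ≡.cong₂ _∨_ (dec-false (_ ≟ k) i≢k) (listed-∉ ks i∉ks)

  listed-∈ : ∀ {i} ks → i ∈ ks → listed ks i ≡ true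
  listed-∈ (k ∷ ks) (here ≡.refl) = ≡.cong (_∨ listed ks k) (dec-true (k ≟ k) ≡.refl)
  listed-∈ (k ∷ ks) (there i∈ks)  = ≡.trans (≡.cong (_ ∨_) (listed-∈ ks i∈ks)) (∨-zeroʳ _)

  selected : {P : Fin n → Set} → Decidable P → List (Fin n) → Fin n → Bool
  selected P? ks i = does (P? i) ∧ listed ks i

  NoEdgesAcross-onCliques : (g : Fin n → Bool) (k : Fin n) → NoEdgesAcross (onCliques g) (inClique k)
  NoEdgesAcross-onCliques g k = NoEdgesAcross-index (onCliques g) (atIndex k) (λ u gu _ → onCliques-nonoriginal g u gu)

  module _ {P : Fin n → Set} (P? : Decidable P) (k : Fin n) (ks : List (Fin n)) where

    onCliques-∷-inClique : ∀ {b} → does (P? k) ≡ b →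
      ∀ u → (onCliques (selected P? (k ∷ ks)) ∧̇ inClique k) u ≡ b ∧ onCliques (atIndex k) u
    onCliques-∷-inClique {b} Pk (i , j) with i ≟ k
    ... | no  _      = ≡.trans (∧-zeroʳ _) (≡.sym (∧-zeroʳ b))
    ... | yes ≡.refl rewrite Pk = ≡.trans (∧-identityʳ _) (≡.cong (_∧ not (original (i , j))) (∧-identityʳ b))

    onCliques-∷-¬inClique : All (λ k′ → ¬ k ≡ k′) ks →
      ∀ u → (onCliques (selected P? (k ∷ ks)) ∧̇ ¬̇ inClique k) u ≡ onCliques (selected P? ks) u
    onCliques-∷-¬inClique k∉ks (i , j) with i ≟ k
    ... | no  _      = ∧-identityʳ _
    ... | yes ≡.refl = ≡.trans (∧-zeroʳ _) (≡.sym (≡.cong (_∧ not (original (i , j)))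
                         (≡.trans (≡.cong (does (P? i) ∧_) (listed-∉ ks k∉ks)) (∧-zeroʳ _))))

  -- The non-original vertices of distinct cliques are pairwise non-adjacent, so the polynomial factors.
  indPoly-selected : {P : Fin n → Set} (P? : Decidable P) (ks : List (Fin n)) → Unique ks →
    indPoly vertices (onCliques (selected P? ks)) ≈ prodR R (map cliqueFactor (filter P? ks))
  indPoly-selected P? [] _ = indPoly-false vertices _ (All.tabulate (λ {u} _ →
    ≡.cong (_∧ not (original u)) (∧-zeroʳ (does (P? (proj₁ u))))))
  indPoly-selected P? (k ∷ ks) (k∉ks ∷ uniq) with does (P? k) in Pk
  ... | true  = begin
    indPoly vertices p
      ≈⟨ indPoly-split vertices p (inClique k) (NoEdgesAcross-onCliques _ k) ⟩
    indPoly vertices (p ∧̇ inClique k) * indPoly vertices (p ∧̇ ¬̇ inClique k)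
      ≈⟨ *-cong (indPoly-cong vertices (onCliques-∷-inClique P? k ks Pk))
                (indPoly-cong vertices (onCliques-∷-¬inClique P? k ks k∉ks)) ⟩
    indPoly vertices (onCliques (atIndex k)) * indPoly vertices (onCliques (selected P? ks))
      ≈⟨ *-cong (indPoly-clique-nonoriginal k) (indPoly-selected P? ks uniq) ⟩
    cliqueFactor k * prodR R (map cliqueFactor (filter P? ks))             ∎
    where p = onCliques (selected P? (k ∷ ks))
  ... | false = begin
    indPoly vertices p
      ≈⟨ indPoly-split vertices p (inClique k) (NoEdgesAcross-onCliques _ k) ⟩
    indPoly vertices (p ∧̇ inClique k) * indPoly vertices (p ∧̇ ¬̇ inClique k)
      ≈⟨ *-cong (indPoly-false vertices _ (All.tabulate (λ {u} _ → onCliques-∷-inClique P? k ks Pk u)))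
                (indPoly-cong vertices (onCliques-∷-¬inClique P? k ks k∉ks)) ⟩
    1# * indPoly vertices (onCliques (selected P? ks))                     ≈⟨ *-identityˡ _ ⟩
    indPoly vertices (onCliques (selected P? ks))                          ≈⟨ indPoly-selected P? ks uniq ⟩
    prodR R (map cliqueFactor (filter P? ks))                              ∎
    where p = onCliques (selected P? (k ∷ ks))

  indPoly-onCliques : {P : Fin n → Set} (P? : Decidable P) →
    indPoly vertices (onCliques (λ i → does (P? i))) ≈ prodR R (map cliqueFactor (filter P? (allFin n)))
  indPoly-onCliques P? = trans (indPoly-cong vertices all-listed) (indPoly-selected P? (allFin n) (Unique.allFin⁺ n))
    where
    all-listed : ∀ u → onCliques (λ i → does (P? i)) u ≡ onCliques (selected P? (allFin n)) u
    all-listed u = ≡.cong (_∧ not (original u)) (≡.sym (≡.trans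
      (≡.cong (does (P? (proj₁ u)) ∧_) (listed-∈ (allFin n) (∈-allFin (proj₁ u)))) (∧-identityʳ _)))

module LastVertex {c ℓ : Level} (R : CommutativeRing c ℓ) {n' : ℕ} (G : SimpleGraph (suc n'))
    (a : Fin (suc n') → ℕ) (x : Fin (suc n') → CommutativeRing.Carrier R) (a-pos : ∀ i → 1 ≤ a i) (d : ℕ)
    (N[vₙ] : ∀ j → SimpleGraph.Adj G (fromℕ n') j ⇔ ((n' ∸ d ≤ toℕ j) × (toℕ j < n'))) where
  open CommutativeRing R
  open CliqueExtension R G a x public
  open import Relation.Binary.Reasoning.Setoid setoid

  top : Fin (suc n')
  top = fromℕ n'

  vₙ : V
  vₙ = top , fromℕ< (a-pos top)

  isVₙ : V → Bool
  isVₙ = inClique top ∧̇ original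

  vₙ-original : toℕ (proj₂ vₙ) ≡ 0
  vₙ-original = toℕ-fromℕ< (a-pos top)

  isVₙ-vₙ : isVₙ vₙ ≡ true
  isVₙ-vₙ = ≡.cong₂ _∧_ (dec-true (top ≟ top) ≡.refl) (dec-true (_ ℕ.≟ 0) vₙ-original)

  isVₙ⇒vₙ : ∀ u → isVₙ u ≡ true → u ≡ vₙ
  isVₙ⇒vₙ (i , k) = by-cases (i ≟ top) (toℕ k ℕ.≟ 0)
    where
    by-cases : (i≟top : Dec (i ≡ top)) (k≟0 : Dec (toℕ k ≡ 0)) → does i≟top ∧ does k≟0 ≡ true → (i , k) ≡ vₙ
    by-cases (yes ≡.refl) (yes k≡0) _ = ≡.cong (top ,_) (toℕ-injective (≡.trans k≡0 (≡.sym vₙ-original)))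
    by-cases (yes _)      (no _)    ()
    by-cases (no _)       _         ()

  below-or-top : (i : Fin (suc n')) → toℕ i < n' ⊎ i ≡ top
  below-or-top i with toℕ i <? n'
  ... | yes i<n' = inj₁ i<n'
  ... | no  i≮n' =
    inj₂ (toℕ-injective (≡.trans (ℕ.≤-antisym (toℕ≤pred[n] i) (ℕ.≮⇒≥ i≮n')) (≡.sym (toℕ-fromℕ n'))))

  below⇒≢top : ∀ {i} → toℕ i < n' → ¬ i ≡ top
  below⇒≢top i<n' ≡.refl = ℕ.<-irrefl (toℕ-fromℕ n') i<n'

  top-∉G : ∀ {m} → m ≤ n' → (k : Fin (a top)) → inG m (top , k) ≡ false
  top-∉G m≤n' k = dec-false (toℕ top <? _) λ top<m →
    ℕ.<-irrefl ≡.refl (ℕ.<-≤-trans (≡.subst (_< _) (toℕ-fromℕ n') top<m) m≤n')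

  adj-vₙ-top : (k : Fin (a top)) → adj vₙ (top , k) ≡ not (original (top , k))
  adj-vₙ-top k = by-cases (toℕ k ℕ.≟ 0)
    where
    by-cases : (k≟0 : Dec (toℕ k ≡ 0)) → adj vₙ (top , k) ≡ not (does k≟0)
    by-cases (yes k≡0) = dec-false (CAdj? G a vₙ (top , k)) λ
      { (inj₁ (_ , 0≢k))      → 0≢k (≡.trans vₙ-original (≡.sym k≡0))
      ; (inj₂ (top~top , _)) → SimpleGraph.irrefl G ≡.refl top~top }
    by-cases (no k≢0)  =
      dec-true (CAdj? G a vₙ (top , k)) (inj₁ (≡.refl , λ 0≡k → k≢0 (≡.trans (≡.sym 0≡k) vₙ-original)))

  atOrAbove : Fin (suc n') → Bool
  atOrAbove i = does (n' ∸ d ≤? toℕ i)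

  adj-vₙ-below : (i : Fin (suc n')) (k : Fin (a i)) → toℕ i < n' → adj vₙ (i , k) ≡ atOrAbove i ∧ original (i , k)
  adj-vₙ-below i k i<n' = by-cases (n' ∸ d ≤? toℕ i) (toℕ k ℕ.≟ 0)
    where
    by-cases : (lo≤?i : Dec (n' ∸ d ≤ toℕ i)) (k≟0 : Dec (toℕ k ≡ 0)) → adj vₙ (i , k) ≡ does lo≤?i ∧ does k≟0
    by-cases (yes lo≤i) (yes k≡0) =
      dec-true (CAdj? G a vₙ (i , k)) (inj₂ (Equivalence.from (N[vₙ] i) (lo≤i , i<n') , vₙ-original , k≡0))
    by-cases (yes _)    (no k≢0)  = dec-false (CAdj? G a vₙ (i , k)) λ
      { (inj₁ (top≡i , _))   → below⇒≢top i<n' (≡.sym top≡i)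
      ; (inj₂ (_ , _ , k≡0)) → k≢0 k≡0 }
    by-cases (no lo≰i)  _         = dec-false (CAdj? G a vₙ (i , k)) λ
      { (inj₁ (top≡i , _)) → below⇒≢top i<n' (≡.sym top≡i)
      ; (inj₂ (top~i , _)) → lo≰i (proj₁ (Equivalence.to (N[vₙ] i) top~i)) }

  indPoly-without-vₙ : indPoly vertices (¬̇ isVₙ) ≈ cliqueFactor top * indPoly vertices (inG n')
  indPoly-without-vₙ = begin
    indPoly vertices (¬̇ isVₙ)
      ≈⟨ indPoly-split vertices _ (inClique top) (NoEdgesAcross-index _ (atIndex top) nonoriginal) ⟩
    indPoly vertices (¬̇ isVₙ ∧̇ inClique top) * indPoly vertices (¬̇ isVₙ ∧̇ ¬̇ inClique top)
      ≈⟨ *-cong (indPoly-cong vertices (λ u → not-∧-∧ (inClique top u) (original u))) (indPoly-cong vertices rest) ⟩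
    indPoly vertices (onCliques (atIndex top)) * indPoly vertices (inG n')
      ≈⟨ *-congʳ (indPoly-clique-nonoriginal top) ⟩
    cliqueFactor top * indPoly vertices (inG n') ∎
    where
    nonoriginal : ∀ u → (¬̇ isVₙ) u ≡ true → atIndex top (proj₁ u) ≡ true → original u ≡ false
    nonoriginal u ¬isVₙ inTop = not-injective (≡.subst (λ t → not (t ∧ original u) ≡ true) inTop ¬isVₙ)
    rest : ∀ u → (¬̇ isVₙ ∧̇ ¬̇ inClique top) u ≡ inG n' u
    rest (i , k) with below-or-top i
    ... | inj₁ i<n'   = ≡.trans (≡.cong (λ t → not (t ∧ original (i , k)) ∧ not t)
                                        (dec-false (i ≟ top) (below⇒≢top i<n')))
                                (≡.sym (dec-true (toℕ i <? n') i<n'))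
    ... | inj₂ ≡.refl = ≡.trans (not-∧-∧-not (inClique top (top , k)) (original (top , k)))
                                (≡.trans (≡.cong not (dec-true (top ≟ top) ≡.refl)) (≡.sym (top-∉G ℕ.≤-refl k)))

  nonadjVₙ : V → Bool
  nonadjVₙ = ¬̇ isVₙ ∧̇ nonadj vₙ

  nonadjVₙ-top : (k : Fin (a top)) → nonadjVₙ (top , k) ≡ false
  nonadjVₙ-top k = ≡.trans (≡.cong₂ (λ t b → not (t ∧ original (top , k)) ∧ not b)
                                    (dec-true (top ≟ top) ≡.refl) (adj-vₙ-top k))
                           (∧-inverseʳ (not (original (top , k))))

  nonadjVₙ-below : (i : Fin (suc n')) (k : Fin (a i)) → toℕ i < n' →
                   nonadjVₙ (i , k) ≡ not (atOrAbove i ∧ original (i , k))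
  nonadjVₙ-below i k i<n' = ≡.cong₂ (λ t b → not (t ∧ original (i , k)) ∧ not b)
                                     (dec-false (i ≟ top) (below⇒≢top i<n')) (adj-vₙ-below i k i<n')

  neighbour? : (i : Fin (suc n')) → Dec ((n' ∸ d ≤ toℕ i) × (toℕ i < n'))
  neighbour? i = (n' ∸ d ≤? toℕ i) ×-dec (toℕ i <? n')

  -- A vertex outside N[vₙ] lying in a neighbour clique is not original, hence adjacent only within its clique.
  indPoly-without-N[vₙ] : indPoly vertices nonadjVₙ ≈
    prodR R (map cliqueFactor (filter neighbour? (allFin (suc n')))) * indPoly vertices (inG (n' ∸ d))
  indPoly-without-N[vₙ] = begin
    indPoly vertices nonadjVₙ
      ≈⟨ indPoly-split vertices _ (atOrAbove ∘ proj₁) (NoEdgesAcross-index _ atOrAbove nonoriginal) ⟩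
    indPoly vertices (nonadjVₙ ∧̇ atOrAbove ∘ proj₁) * indPoly vertices (nonadjVₙ ∧̇ ¬̇ (atOrAbove ∘ proj₁))
      ≈⟨ *-cong (trans (indPoly-cong vertices near) (indPoly-onCliques neighbour?)) (indPoly-cong vertices far) ⟩
    prodR R (map cliqueFactor (filter neighbour? (allFin (suc n')))) * indPoly vertices (inG (n' ∸ d)) ∎
    where
    nonoriginal : ∀ u → nonadjVₙ u ≡ true → atOrAbove (proj₁ u) ≡ true → original u ≡ false
    nonoriginal (i , k) nonadj above with below-or-top i
    ... | inj₁ i<n'   = not-injective (≡.subst (λ g → not (g ∧ original (i , k)) ≡ true) above
                                        (≡.trans (≡.sym (nonadjVₙ-below i k i<n')) nonadj))
    ... | inj₂ ≡.refl = contradiction (≡.trans (≡.sym (nonadjVₙ-top k)) nonadj) λ ()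
    near : ∀ u → (nonadjVₙ ∧̇ atOrAbove ∘ proj₁) u ≡ onCliques (λ i → does (neighbour? i)) u
    near (i , k) with below-or-top i
    ... | inj₁ i<n'   = ≡.trans (≡.cong (_∧ atOrAbove i) (nonadjVₙ-below i k i<n'))
                          (≡.trans (not-∧-∧ (atOrAbove i) (original (i , k)))
                                   (≡.sym (≡.trans (≡.cong (λ b → (atOrAbove i ∧ b) ∧ not (original (i , k)))
                                                           (dec-true (toℕ i <? n') i<n'))
                                                   (≡.cong (_∧ not (original (i , k))) (∧-identityʳ (atOrAbove i))))))
    ... | inj₂ ≡.refl = ≡.trans (≡.cong (_∧ atOrAbove top) (nonadjVₙ-top k))
                          (≡.sym (≡.trans (≡.cong (λ b → (atOrAbove top ∧ b) ∧ not (original (top , k)))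
                                                  (top-∉G ℕ.≤-refl k))
                                          (≡.cong (_∧ not (original (top , k))) (∧-zeroʳ (atOrAbove top)))))
    far : ∀ u → (nonadjVₙ ∧̇ ¬̇ (atOrAbove ∘ proj₁)) u ≡ inG (n' ∸ d) u
    far (i , k) with below-or-top i
    ... | inj₁ i<n'   = ≡.trans (≡.cong (_∧ not (atOrAbove i)) (nonadjVₙ-below i k i<n'))
                          (≡.trans (not-∧-∧-not (atOrAbove i) (original (i , k)))
                                   (does-⇔ (mk⇔ ℕ.≰⇒> ℕ.<⇒≱) (¬? (n' ∸ d ≤? toℕ i)) (toℕ i <? n' ∸ d)))
    ... | inj₂ ≡.refl = ≡.trans (≡.cong (_∧ not (atOrAbove top)) (nonadjVₙ-top k))
                                (≡.sym (top-∉G (ℕ.m∸n≤m n' d) k))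

theorem5p1 : {c ℓ : Level} (R : CommutativeRing c ℓ) (n' : ℕ) (G : SimpleGraph (suc n'))
  (a : Fin (suc n') → ℕ) → (∀ i → 1 ≤ a i) → (d : ℕ) → d ≤ n' →
  (∀ j → SimpleGraph.Adj G (fromℕ n') j ⇔ ((n' ∸ d ≤ toℕ j) × (toℕ j < n'))) →
  (x : Fin (suc n') → CommutativeRing.Carrier R) →
  let open CommutativeRing R
      P = λ m → redIndPoly R G a m x
  in P (suc n') ≈
     (P n' + ((x (fromℕ n') * natR R (a (fromℕ n') ∸ 1))) * P n')
     + (P (n' ∸ d) * x (fromℕ n'))
       * prodR R (map (λ k → x k * natR R (a k ∸ 1) + 1#)
                      (filter (λ k → (n' ∸ d ≤? toℕ k) ×-dec (toℕ k <? n')) (allFin (suc n'))))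
theorem5p1 R n' G a a-pos d _ N[vₙ] x = begin
  P (suc n')                                                  ≈⟨ redIndPoly≈indPoly (suc n') ⟩
  indPoly vertices (inG (suc n'))                             ≈⟨ indPoly-cong vertices everywhere ⟩
  indPoly vertices (λ _ → true)
    ≈⟨ indPoly-delete vertices _ isVₙ vertices-unique (∈-vertices vₙ) isVₙ-vₙ isVₙ⇒vₙ ⟩
  indPoly vertices (¬̇ isVₙ) + x top * indPoly vertices nonadjVₙ
    ≈⟨ +-cong indPoly-without-vₙ (*-congˡ indPoly-without-N[vₙ]) ⟩
  cliqueFactor top * indPoly vertices (inG n') + x top * (Π * indPoly vertices (inG (n' ∸ d)))
    ≈⟨ +-cong (*-congˡ (sym (redIndPoly≈indPoly n'))) (*-congˡ (*-congˡ (sym (redIndPoly≈indPoly (n' ∸ d))))) ⟩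
  cliqueFactor top * P n' + x top * (Π * P (n' ∸ d))        ≈⟨ +-cong expand rearrange ⟩
  (P n' + (x top * natR R (a top ∸ 1)) * P n') + (P (n' ∸ d) * x top) * Π ∎
  where
  open CommutativeRing R
  open IndependencePolynomial R
  open LastVertex R G a x a-pos d N[vₙ]
  open import Relation.Binary.Reasoning.Setoid setoid
  P = λ m → redIndPoly R G a m x
  Π = prodR R (map cliqueFactor (filter neighbour? (allFin (suc n'))))
  everywhere : ∀ u → inG (suc n') u ≡ true
  everywhere u = dec-true (toℕ (proj₁ u) <? suc n') (toℕ<n (proj₁ u))
  expand : cliqueFactor top * P n' ≈ P n' + (x top * natR R (a top ∸ 1)) * P n'
  expand = trans (distribʳ (P n') _ 1#) (trans (+-comm _ _) (+-congʳ (*-identityˡ (P n'))))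
  rearrange : x top * (Π * P (n' ∸ d)) ≈ (P (n' ∸ d) * x top) * Π
  rearrange = trans (*.x∙yz≈y∙xz (x top) Π _) (trans (*-comm Π _) (*-congʳ (*-comm (x top) _)))
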